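{- Let $G$ be a circuit with leaves labeled by literals over $\mathbf{I}$ and $\mathbf{X}$, and let $G_1,G_2$ be sub-circuits of $G$ such that neither is a sub-circuit of the other. Let $p\notin\mathrm{set}(\mathbf{X})\cup\mathrm{set}(\mathbf{I})$ be a fresh variable. If $\varphi_{G_1}\wedge\varphi_{G_2}$ is unsatisfiable, then $G$ is equisynthesizable under projection to $T_1^{p}(T_2^{\neg p}(G))$ (with auxiliary output sequence $(p)$).
   Context: $\mathbf{I}$ (system inputs) and $\mathbf{X}$ (system outputs) are disjoint sequences of Boolean variables; $\mathrm{set}(\mathbf{V})$ is the set of variables of $\mathbf{V}$. A circuit is an NNF circuit: a rooted DAG, all nodes descendants of the root, internal nodes labeled $\wedge$ or $\vee$ with two children, leaves labeled by literals or constants; $\varphi_G$ is the represented formula. A sub-circuit is the circuit rooted at some node. For $j\in\{1,2\}$ and a literal $q$, $T_j^{q}$ is the transformation that replaces the sub-circuit $G_j$ in $G$ by a circuit representing $\varphi_{G_j}\wedge q$. For a circuit $G$ over $\mathbf{I},\mathbf{X}$ and a circuit $H$ over $\mathbf{I},\mathbf{X},\mathbf{X}'$ with $\mathbf{X}'$ fresh, $G$ is equisynthesizable to $H$ under projection iff $\forall\mathbf{I}\forall\mathbf{X}\,(\varphi_G(\mathbf{X},\mathbf{I})\Rightarrow\exists\mathbf{X}'\varphi_H(\mathbf{X},\mathbf{X}',\mathbf{I}))$ and $\forall\mathbf{I}\forall\mathbf{X}\forall\mathbf{X}'\,(\varphi_H(\mathbf{X},\mathbf{X}',\mathbf{I})\Rightarrow\varphi_G(\mathbf{X},\mathbf{I}))$.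 -}

module Defs where

open import Data.Nat using (ℕ; suc; _+_; _<_; _≟_)
open import Data.Bool using (Bool; true; false; not; _∧_; _∨_; if_then_else_)
open import Data.List using (List; _++_)
open import Data.List.Membership.Propositional using (_∈_; _∉_)
open import Data.Product using (_×_; Σ; ∃)
open import Relation.Nullary using (¬_)
open import Relation.Nullary.Decidable using (⌊_⌋)
open import Relation.Binary.PropositionalEquality using (_≡_)
open import Relation.Binary.Construct.Closure.ReflexiveTransitive using (Star)

Var : Set
Var = ℕ

Assignment : Set
Assignment = Var → Bool

data Lit : Set where
  pos : Var → Lit
  neg : Var → Lit

litVar : Lit → Var
litVar (pos v) = v
litVar (neg v) = v

evalLit : Assignment → Lit → Bool
evalLit σ (pos v) = σ v
evalLit σ (neg v) = not (σ v)

-- Node labels of an NNF circuit; internal nodes refer to their two children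
-- by node index.
data Gate : Set where
  leaf  : Lit → Gate
  const : Bool → Gate
  and   : ℕ → ℕ → Gate
  or    : ℕ → ℕ → Gate

-- A circuit: nodes 0 .. size-1, a labelling of nodes, and a root node.
record Circuit : Set where
  constructor circuit
  field
    size : ℕ
    gate : ℕ → Gate
    root : ℕ
open Circuit public

data Edge (G : Circuit) : ℕ → ℕ → Set where
  and-l : ∀ {i j k} → gate G i ≡ and j k → Edge G i j
  and-r : ∀ {i j k} → gate G i ≡ and j k → Edge G i k
  or-l  : ∀ {i j k} → gate G i ≡ or j k → Edge G i j
  or-r  : ∀ {i j k} → gate G i ≡ or j k → Edge G i k

-- Reach G i j : j is a descendant of i (reflexive-transitive), i.e. node j
-- belongs to the sub-circuit rooted at i.
Reach : Circuit → ℕ → ℕ → Set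
Reach G = Star (Edge G)

record WellFormed (G : Circuit) : Set where
  field
    root<size : root G < size G
    child<size : ∀ i j → i < size G → Edge G i j → j < size G
    acyclic : ∀ i j → Edge G i j → ¬ Reach G j i
    rooted : ∀ i → i < size G → Reach G (root G) i

LeavesOver : List Var → Circuit → Set
LeavesOver Vs G = ∀ i l → i < size G → gate G i ≡ leaf l → litVar l ∈ Vs

-- Semantics: Val G σ i b  means node i evaluates to b under σ, i.e.
-- φ_{G_i}(σ) = b where G_i is the sub-circuit rooted at i.
data Val (G : Circuit) (σ : Assignment) : ℕ → Bool → Set where
  v-leaf  : ∀ {i l} → gate G i ≡ leaf l → Val G σ i (evalLit σ l)
  v-const : ∀ {i b} → gate G i ≡ const b → Val G σ i b
  v-and   : ∀ {i j k a b} → gate G i ≡ and j k →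
            Val G σ j a → Val G σ k b → Val G σ i (a ∧ b)
  v-or    : ∀ {i j k a b} → gate G i ≡ or j k →
            Val G σ j a → Val G σ k b → Val G σ i (a ∨ b)

Sat : Circuit → Assignment → Set
Sat G σ = Val G σ (root G) true

-- Transformation T^q at node k: add a leaf node q (index size) and a node
-- (k ∧ q) (index size+1), and redirect every edge into k (and the root, if
-- it is k) to the new ∧-node.
redirect : ℕ → ℕ → ℕ → ℕ
redirect k new j = if ⌊ j ≟ k ⌋ then new else j

redirectGate : ℕ → ℕ → Gate → Gate
redirectGate k new (leaf l)  = leaf l
redirectGate k new (const b) = const b
redirectGate k new (and j m) = and (redirect k new j) (redirect k new m)
redirectGate k new (or j m)  = or (redirect k new j) (redirect k new m)

T : ℕ → Lit → Circuit → Circuit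
T k q G = circuit (suc (suc n)) g (redirect k (suc n) (root G))
  where
    n = size G
    g : ℕ → Gate
    g i = if ⌊ i ≟ n ⌋ then leaf q
          else if ⌊ i ≟ suc n ⌋ then and k n
          else redirectGate k (suc n) (gate G i)

AgreeOutside : List Var → Assignment → Assignment → Set
AgreeOutside Xs σ τ = ∀ v → v ∉ Xs → σ v ≡ τ v

EquisynthProj : Circuit → Circuit → List Var → Set
EquisynthProj G H X' =
  (∀ σ → Sat G σ → ∃ λ τ → AgreeOutside X' σ τ × Sat H τ) ×
  (∀ σ → Sat H σ → Sat G σ)

-- Conjoining a literal q below node k can only lower the value of every
-- node, so φ_H ⇒ φ_G.  Conversely, if q holds whenever node k does, then
-- k ∧ q has the value of k and the transformed circuit computes exactly what
-- the original does.  Setting the fresh variable p to the value of G₁ makes p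
-- implied by G₁, and ¬p implied by G₂ since G₁ ∧ G₂ is unsatisfiable.

module Submission where

open import Defs
open import Data.Nat using (ℕ; _<_; suc; _≟_)
open import Data.Nat.Properties using (<⇒≢; m<n⇒m<1+n; n<1+n; 1+n≢n; m<1+n⇒m<n∨m≡n)
open import Data.Bool using (Bool; true; false; not; _∧_; _∨_; if_then_else_; _≤_; f≤t; b≤b)
open import Data.Bool.Properties using (≤-refl; ≤-trans; ≤-minimum; ≤-maximum)
open import Data.List using (List; _++_; [_])
open import Data.List.Membership.Propositional using (_∈_; _∉_)
open import Data.List.Membership.Propositional.Properties using (∈-++⁻)
open import Data.List.Relation.Unary.Any using (here)
open import Data.Product using (_×_; _,_; ∃; ∃₂; proj₂)
open import Data.Sum using (_⊎_; inj₁; inj₂)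
import Data.Sum as Sum
open import Relation.Nullary using (¬_; yes; no; contradiction)
open import Relation.Nullary.Decidable using (⌊_⌋)
open import Relation.Binary.PropositionalEquality
  using (_≡_; _≢_; refl; sym; trans; cong; cong₂; subst)
open import Relation.Binary.Construct.Closure.ReflexiveTransitive using (ε; _◅_)

variable
  G : Circuit
  σ τ : Assignment
  i j k m x y : ℕ
  a b c d : Bool
  l : Lit

∧-≤ˡ : a ∧ b ≤ a
∧-≤ˡ {true} = ≤-maximum _
∧-≤ˡ {false} = b≤b

∧-mono-≤ : a ≤ b → c ≤ d → a ∧ c ≤ b ∧ d
∧-mono-≤ f≤t _ = ≤-minimum _
∧-mono-≤ {true} b≤b c≤d = c≤d
∧-mono-≤ {false} b≤b _ = b≤b

∨-mono-≤ : a ≤ b → c ≤ d → a ∨ c ≤ b ∨ d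
∨-mono-≤ f≤t _ = ≤-maximum _
∨-mono-≤ {true} b≤b _ = b≤b
∨-mono-≤ {false} b≤b c≤d = c≤d

≤⇒∧≡ : a ≤ b → a ∧ b ≡ a
≤⇒∧≡ f≤t = refl
≤⇒∧≡ {true} b≤b = refl
≤⇒∧≡ {false} b≤b = refl

if-≟-yes : ∀ {A : Set} {u v : A} {i j} → i ≡ j → (if ⌊ i ≟ j ⌋ then u else v) ≡ u
if-≟-yes {i = i} {j = j} i≡j with i ≟ j
... | yes _ = refl
... | no i≢j = contradiction i≡j i≢j

if-≟-no : ∀ {A : Set} {u v : A} {i j} → i ≢ j → (if ⌊ i ≟ j ⌋ then u else v) ≡ v
if-≟-no {i = i} {j = j} i≢j with i ≟ j
... | yes i≡j = contradiction i≡j i≢j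
... | no _ = refl

update : Assignment → Var → Bool → Assignment
update σ p b v with v ≟ p
... | yes _ = b
... | no _ = σ v

update-≡ : ∀ {p} → update σ p b p ≡ b
update-≡ {p = p} with p ≟ p
... | yes _ = refl
... | no p≢p = contradiction refl p≢p

update-≢ : ∀ {p v} → v ≢ p → update σ p b v ≡ σ v
update-≢ {p = p} {v} v≢p with v ≟ p
... | yes v≡p = contradiction v≡p v≢p
... | no _ = refl

update-agreeOutside : ∀ {p} → AgreeOutside [ p ] σ (update σ p b)
update-agreeOutside v v∉[p] = sym (update-≢ (λ v≡p → v∉[p] (here v≡p)))

evalLit-cong : ∀ l → σ (litVar l) ≡ τ (litVar l) → evalLit σ l ≡ evalLit τ l
evalLit-cong (pos _) eq = eq
evalLit-cong (neg _) eq = cong not eq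

Val-leaf⁻¹ : gate G i ≡ leaf l → Val G σ i b → b ≡ evalLit σ l
Val-leaf⁻¹ e (v-leaf e′) with trans (sym e) e′
... | refl = refl
Val-leaf⁻¹ e (v-const e′) = contradiction (trans (sym e) e′) λ ()
Val-leaf⁻¹ e (v-and e′ _ _) = contradiction (trans (sym e) e′) λ ()
Val-leaf⁻¹ e (v-or e′ _ _) = contradiction (trans (sym e) e′) λ ()

Val-const⁻¹ : gate G i ≡ const c → Val G σ i b → b ≡ c
Val-const⁻¹ e (v-leaf e′) = contradiction (trans (sym e) e′) λ ()
Val-const⁻¹ e (v-const e′) with trans (sym e) e′
... | refl = refl
Val-const⁻¹ e (v-and e′ _ _) = contradiction (trans (sym e) e′) λ ()
Val-const⁻¹ e (v-or e′ _ _) = contradiction (trans (sym e) e′) λ ()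

Val-and⁻¹ : gate G i ≡ and x y → Val G σ i b →
            ∃₂ λ a c → Val G σ x a × Val G σ y c × b ≡ a ∧ c
Val-and⁻¹ e (v-leaf e′) = contradiction (trans (sym e) e′) λ ()
Val-and⁻¹ e (v-const e′) = contradiction (trans (sym e) e′) λ ()
Val-and⁻¹ e (v-and e′ v₁ v₂) with trans (sym e) e′
... | refl = _ , _ , v₁ , v₂ , refl
Val-and⁻¹ e (v-or e′ _ _) = contradiction (trans (sym e) e′) λ ()

Val-or⁻¹ : gate G i ≡ or x y → Val G σ i b →
           ∃₂ λ a c → Val G σ x a × Val G σ y c × b ≡ a ∨ c
Val-or⁻¹ e (v-leaf e′) = contradiction (trans (sym e) e′) λ ()
Val-or⁻¹ e (v-const e′) = contradiction (trans (sym e) e′) λ ()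
Val-or⁻¹ e (v-and e′ _ _) = contradiction (trans (sym e) e′) λ ()
Val-or⁻¹ e (v-or e′ v₁ v₂) with trans (sym e) e′
... | refl = _ , _ , v₁ , v₂ , refl

Val-functional : Val G σ i a → Val G σ i b → a ≡ b
Val-functional (v-leaf e) v = sym (Val-leaf⁻¹ e v)
Val-functional (v-const e) v = sym (Val-const⁻¹ e v)
Val-functional (v-and e v₁ v₂) v with Val-and⁻¹ e v
... | _ , _ , v₁′ , v₂′ , refl = cong₂ _∧_ (Val-functional v₁ v₁′) (Val-functional v₂ v₂′)
Val-functional (v-or e v₁ v₂) v with Val-or⁻¹ e v
... | _ , _ , v₁′ , v₂′ , refl = cong₂ _∨_ (Val-functional v₁ v₁′) (Val-functional v₂ v₂′)

Val-child : Val G σ i b → Edge G i j → ∃ (Val G σ j)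
Val-child v (and-l e) with Val-and⁻¹ e v
... | _ , _ , v₁ , _ , _ = _ , v₁
Val-child v (and-r e) with Val-and⁻¹ e v
... | _ , _ , _ , v₂ , _ = _ , v₂
Val-child v (or-l e) with Val-or⁻¹ e v
... | _ , _ , v₁ , _ , _ = _ , v₁
Val-child v (or-r e) with Val-or⁻¹ e v
... | _ , _ , _ , v₂ , _ = _ , v₂

Val-reach : Val G σ i b → Reach G i j → ∃ (Val G σ j)
Val-reach v ε = _ , v
Val-reach v (e ◅ r) = Val-reach (proj₂ (Val-child v e)) r

Val-exclusive : ¬ (Val G σ i true × Val G σ j true) → Val G σ i a → Val G σ j b → b ≤ not a
Val-exclusive {a = false} _ _ _ = ≤-maximum _
Val-exclusive {a = true} {b = false} _ _ _ = b≤b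
Val-exclusive {a = true} {b = true} exclusive vᵢ vⱼ = contradiction (vᵢ , vⱼ) exclusive

ChildrenBounded : Circuit → Set
ChildrenBounded G = ∀ i j → i < size G → Edge G i j → j < size G

AgreeOnLeaves : Circuit → Assignment → Assignment → Set
AgreeOnLeaves G σ τ = ∀ i l → i < size G → gate G i ≡ leaf l → σ (litVar l) ≡ τ (litVar l)

Val-agree : ChildrenBounded G → AgreeOnLeaves G σ τ → i < size G → Val G σ i b → Val G τ i b
Val-agree {G = G} {τ = τ} _ agree i<n (v-leaf {l = l} e) =
  subst (Val G τ _) (sym (evalLit-cong l (agree _ l i<n e))) (v-leaf e)
Val-agree _ _ _ (v-const e) = v-const e
Val-agree bounded agree i<n (v-and e v₁ v₂) =
  v-and e (Val-agree bounded agree (bounded _ _ i<n (and-l e)) v₁)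
          (Val-agree bounded agree (bounded _ _ i<n (and-r e)) v₂)
Val-agree bounded agree i<n (v-or e v₁ v₂) =
  v-or e (Val-agree bounded agree (bounded _ _ i<n (or-l e)) v₁)
         (Val-agree bounded agree (bounded _ _ i<n (or-r e)) v₂)

FreshIn : Var → Circuit → Set
FreshIn p G = ∀ i l → i < size G → gate G i ≡ leaf l → litVar l ≢ p

LeavesOver-fresh : ∀ {Vs p} → LeavesOver Vs G → p ∉ Vs → FreshIn p G
LeavesOver-fresh leaves p∉Vs i l i<n e refl = p∉Vs (leaves i l i<n e)

Val-update-fresh : ∀ {p} → ChildrenBounded G → FreshIn p G → i < size G →
                   Val G σ i b → Val G (update σ p c) i b
Val-update-fresh bounded fresh = Val-agree bounded λ i l i<n e → sym (update-≢ (fresh i l i<n e))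

Edge-leaf⁻¹ : gate G i ≡ leaf l → ¬ Edge G i j
Edge-leaf⁻¹ e (and-l e′) = contradiction (trans (sym e) e′) λ ()
Edge-leaf⁻¹ e (and-r e′) = contradiction (trans (sym e) e′) λ ()
Edge-leaf⁻¹ e (or-l e′) = contradiction (trans (sym e) e′) λ ()
Edge-leaf⁻¹ e (or-r e′) = contradiction (trans (sym e) e′) λ ()

Edge-and⁻¹ : gate G i ≡ and x y → Edge G i j → j ≡ x ⊎ j ≡ y
Edge-and⁻¹ e (and-l e′) with trans (sym e) e′
... | refl = inj₁ refl
Edge-and⁻¹ e (and-r e′) with trans (sym e) e′
... | refl = inj₂ refl
Edge-and⁻¹ e (or-l e′) = contradiction (trans (sym e) e′) λ ()
Edge-and⁻¹ e (or-r e′) = contradiction (trans (sym e) e′) λ ()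

redirectGate-leaf⁻¹ : ∀ g → redirectGate k m g ≡ leaf l → g ≡ leaf l
redirectGate-leaf⁻¹ (leaf _) refl = refl
redirectGate-leaf⁻¹ (const _) ()
redirectGate-leaf⁻¹ (and _ _) ()
redirectGate-leaf⁻¹ (or _ _) ()

redirectGate-const⁻¹ : ∀ g → redirectGate k m g ≡ const c → g ≡ const c
redirectGate-const⁻¹ (leaf _) ()
redirectGate-const⁻¹ (const _) refl = refl
redirectGate-const⁻¹ (and _ _) ()
redirectGate-const⁻¹ (or _ _) ()

redirectGate-and⁻¹ : ∀ g → redirectGate k m g ≡ and x y →
                     ∃₂ λ x′ y′ → g ≡ and x′ y′ × x ≡ redirect k m x′ × y ≡ redirect k m y′
redirectGate-and⁻¹ (leaf _) ()
redirectGate-and⁻¹ (const _) ()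
redirectGate-and⁻¹ (and x′ y′) refl = x′ , y′ , refl , refl , refl
redirectGate-and⁻¹ (or _ _) ()

redirectGate-or⁻¹ : ∀ g → redirectGate k m g ≡ or x y →
                    ∃₂ λ x′ y′ → g ≡ or x′ y′ × x ≡ redirect k m x′ × y ≡ redirect k m y′
redirectGate-or⁻¹ (leaf _) ()
redirectGate-or⁻¹ (const _) ()
redirectGate-or⁻¹ (and _ _) ()
redirectGate-or⁻¹ (or x′ y′) refl = x′ , y′ , refl , refl , refl

Edge-redirect⁻¹ : ∀ {G H i j k m} → gate H i ≡ redirectGate k m (gate G i) → Edge H i j →
                  ∃ λ x → Edge G i x × j ≡ redirect k m x
Edge-redirect⁻¹ {G = G} {i = i} e (and-l e′) with redirectGate-and⁻¹ (gate G i) (trans (sym e) e′)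
... | x , _ , g≡ , refl , _ = x , and-l g≡ , refl
Edge-redirect⁻¹ {G = G} {i = i} e (and-r e′) with redirectGate-and⁻¹ (gate G i) (trans (sym e) e′)
... | _ , y , g≡ , _ , refl = y , and-r g≡ , refl
Edge-redirect⁻¹ {G = G} {i = i} e (or-l e′) with redirectGate-or⁻¹ (gate G i) (trans (sym e) e′)
... | x , _ , g≡ , refl , _ = x , or-l g≡ , refl
Edge-redirect⁻¹ {G = G} {i = i} e (or-r e′) with redirectGate-or⁻¹ (gate G i) (trans (sym e) e′)
... | _ , y , g≡ , _ , refl = y , or-r g≡ , refl

module Guarding (G : Circuit) (k : ℕ) (q : Lit) (k<n : k < size G)
                (bounded : ChildrenBounded G) where

  private
    n : ℕ
    n = size G

  G⁺ : Circuit
  G⁺ = T k q G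

  gate-old : i < n → gate G⁺ i ≡ redirectGate k (suc n) (gate G i)
  gate-old i<n = trans (if-≟-no (<⇒≢ i<n)) (if-≟-no (<⇒≢ (m<n⇒m<1+n i<n)))

  gate-lit : gate G⁺ n ≡ leaf q
  gate-lit = if-≟-yes {i = n} {j = n} refl

  gate-guard : gate G⁺ (suc n) ≡ and k n
  gate-guard = trans (if-≟-no {i = suc n} {j = n} 1+n≢n) (if-≟-yes {i = suc n} {j = suc n} refl)

  -- Image i j : node i of G⁺ plays the role of node j of G.
  data Image : ℕ → ℕ → Set where
    kept  : j < n → Image j j
    guard : Image (suc n) k

  redirect-image : j < n → Image (redirect k (suc n) j) j
  redirect-image {j} j<n with j ≟ k
  ... | yes refl = guard
  ... | no _ = kept j<n

  Image-< : Image i j → i < size G⁺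
  Image-< (kept j<n) = m<n⇒m<1+n (m<n⇒m<1+n j<n)
  Image-< guard = n<1+n _

  guard-child : j ≡ k ⊎ j ≡ n → j < size G⁺
  guard-child (inj₁ refl) = Image-< (kept k<n)
  guard-child (inj₂ refl) = m<n⇒m<1+n (n<1+n n)

  children-bounded : ChildrenBounded G⁺
  children-bounded i j i<n+2 edge with m<1+n⇒m<n∨m≡n i<n+2
  ... | inj₂ refl = guard-child (Edge-and⁻¹ gate-guard edge)
  ... | inj₁ i<n+1 with m<1+n⇒m<n∨m≡n i<n+1
  ...   | inj₂ refl = contradiction edge (Edge-leaf⁻¹ gate-lit)
  ...   | inj₁ i<n with Edge-redirect⁻¹ (gate-old i<n) edge
  ...     | x , edgeG , refl = Image-< (redirect-image (bounded i x i<n edgeG))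

  root<size : root G < n → root G⁺ < size G⁺
  root<size r<n = Image-< (redirect-image r<n)

  Val-T⁻¹ : Image i j → Val G⁺ τ i b → ∃ λ b′ → Val G τ j b′ × b ≤ b′
  Val-T⁻¹ {j = j} (kept j<n) (v-leaf e) =
    _ , v-leaf (redirectGate-leaf⁻¹ (gate G j) (trans (sym (gate-old j<n)) e)) , ≤-refl
  Val-T⁻¹ {j = j} (kept j<n) (v-const e) =
    _ , v-const (redirectGate-const⁻¹ (gate G j) (trans (sym (gate-old j<n)) e)) , ≤-refl
  Val-T⁻¹ {j = j} (kept j<n) (v-and e v₁ v₂)
    with redirectGate-and⁻¹ (gate G j) (trans (sym (gate-old j<n)) e)
  ... | x , y , g≡ , refl , refl
    with Val-T⁻¹ (redirect-image (bounded j x j<n (and-l g≡))) v₁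
       | Val-T⁻¹ (redirect-image (bounded j y j<n (and-r g≡))) v₂
  ... | _ , w₁ , a≤ | _ , w₂ , c≤ = _ , v-and g≡ w₁ w₂ , ∧-mono-≤ a≤ c≤
  Val-T⁻¹ {j = j} (kept j<n) (v-or e v₁ v₂)
    with redirectGate-or⁻¹ (gate G j) (trans (sym (gate-old j<n)) e)
  ... | x , y , g≡ , refl , refl
    with Val-T⁻¹ (redirect-image (bounded j x j<n (or-l g≡))) v₁
       | Val-T⁻¹ (redirect-image (bounded j y j<n (or-r g≡))) v₂
  ... | _ , w₁ , a≤ | _ , w₂ , c≤ = _ , v-or g≡ w₁ w₂ , ∨-mono-≤ a≤ c≤
  Val-T⁻¹ guard (v-and e v₁ _) with trans (sym gate-guard) e
  ... | refl with Val-T⁻¹ (kept k<n) v₁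
  ...   | _ , w , b≤ = _ , w , ≤-trans ∧-≤ˡ b≤
  Val-T⁻¹ guard (v-leaf e) = contradiction (trans (sym gate-guard) e) λ ()
  Val-T⁻¹ guard (v-const e) = contradiction (trans (sym gate-guard) e) λ ()
  Val-T⁻¹ guard (v-or e _ _) = contradiction (trans (sym gate-guard) e) λ ()

  Sat-T⁻¹ : root G < n → Sat G⁺ τ → Sat G τ
  Sat-T⁻¹ r<n s with Val-T⁻¹ (redirect-image r<n) s
  ... | _ , v , b≤b = v

  module _ {σ : Assignment} (k⇒q : ∀ {b} → Val G σ k b → b ≤ evalLit σ q) where

    mutual
      Val-T-kept : j < n → Val G σ j b → Val G⁺ σ j b
      Val-T-kept j<n (v-leaf e) = v-leaf (trans (gate-old j<n) (cong (redirectGate k (suc n)) e))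
      Val-T-kept j<n (v-const e) = v-const (trans (gate-old j<n) (cong (redirectGate k (suc n)) e))
      Val-T-kept j<n (v-and e v₁ v₂) =
        v-and (trans (gate-old j<n) (cong (redirectGate k (suc n)) e))
              (Val-T (redirect-image (bounded _ _ j<n (and-l e))) v₁)
              (Val-T (redirect-image (bounded _ _ j<n (and-r e))) v₂)
      Val-T-kept j<n (v-or e v₁ v₂) =
        v-or (trans (gate-old j<n) (cong (redirectGate k (suc n)) e))
             (Val-T (redirect-image (bounded _ _ j<n (or-l e))) v₁)
             (Val-T (redirect-image (bounded _ _ j<n (or-r e))) v₂)

      Val-T : Image i j → Val G σ j b → Val G⁺ σ i b
      Val-T (kept j<n) v = Val-T-kept j<n v
      Val-T guard v = subst (Val G⁺ σ (suc n)) (≤⇒∧≡ (k⇒q v))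
                            (v-and gate-guard (Val-T-kept k<n v) (v-leaf gate-lit))

    Sat-T : root G < n → Sat G σ → Sat G⁺ σ
    Sat-T r<n = Val-T (redirect-image r<n)

lemma4 : (I X : List Var) → (∀ v → v ∈ I → v ∉ X) →
         (G : Circuit) → WellFormed G → LeavesOver (I ++ X) G →
         (k₁ k₂ : ℕ) → k₁ < size G → k₂ < size G →
         ¬ Reach G k₁ k₂ → ¬ Reach G k₂ k₁ →
         (p : Var) → p ∉ X → p ∉ I →
         (∀ σ → ¬ (Val G σ k₁ true × Val G σ k₂ true)) →
         EquisynthProj G (T k₁ (pos p) (T k₂ (neg p) G)) [ p ]
lemma4 I X _ G wf leaves k₁ k₂ k₁<n k₂<n _ _ p p∉X p∉I unsat = forward , backward
  where
  open WellFormed wf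
  module G₂ = Guarding G k₂ (neg p) k₂<n child<size
  module G₁ = Guarding G₂.G⁺ k₁ (pos p) (G₂.Image-< (G₂.kept k₁<n)) G₂.children-bounded

  backward : ∀ σ → Sat G₁.G⁺ σ → Sat G σ
  backward σ s = G₂.Sat-T⁻¹ root<size (G₁.Sat-T⁻¹ (G₂.root<size root<size) s)

  fresh : FreshIn p G
  fresh = LeavesOver-fresh {G = G} leaves λ p∈I++X → Sum.[ p∉I , p∉X ] (∈-++⁻ I p∈I++X)

  forward : ∀ σ → Sat G σ → ∃ λ τ → AgreeOutside [ p ] σ τ × Sat G₁.G⁺ τ
  forward σ s with Val-reach s (rooted k₁ k₁<n)
  ... | b₁ , k₁σ = σ′ , update-agreeOutside {p = p} ,
                   G₁.Sat-T k₁⇒p (G₂.root<size root<size)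
                     (G₂.Sat-T k₂⇒¬p root<size (Val-update-fresh child<size fresh root<size s))
    where
    σ′ : Assignment
    σ′ = update σ p b₁

    p↦b₁ : σ′ p ≡ b₁
    p↦b₁ = update-≡ {σ = σ} {p = p}

    k₁σ′ : Val G σ′ k₁ b₁
    k₁σ′ = Val-update-fresh child<size fresh k₁<n k₁σ

    k₂⇒¬p : Val G σ′ k₂ b → b ≤ not (σ′ p)
    k₂⇒¬p v = subst (λ c → _ ≤ not c) (sym p↦b₁) (Val-exclusive (unsat σ′) k₁σ′ v)

    k₁⇒p : Val G₂.G⁺ σ′ k₁ b → b ≤ σ′ p
    k₁⇒p v with G₂.Val-T⁻¹ (G₂.kept k₁<n) v
    ... | _ , v′ , b≤ = subst (_ ≤_) (trans (Val-functional v′ k₁σ′) (sym p↦b₁)) b≤
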